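{- For every fixed $k \in \mathbb{N}$, there exists an interval graph $G_k$ and an orientation $\vec{G}_k$ of $G_k$ such that $\omega(G_k) = k$ and $\vec{\chi}(\vec{G}_k) \geq \lceil k/2 \rceil$.
   Context: An interval graph is a graph whose vertices are intervals of the real line, two vertices being adjacent iff the intervals intersect. An orientation of an undirected graph $G$ is a digraph obtained by replacing each edge $uv$ by exactly one of the arcs $uv$ or $vu$. $\omega(G)$ is the clique number of $G$. For a digraph $D$, a $k$-dicolouring is a map $V(D)\to[k]$ such that each colour class induces an acyclic subdigraph (no monochromatic directed cycle); the dichromatic number $\vec{\chi}(D)$ is the least $k$ for which a $k$-dicolouring exists. -}

module Defs where

open import Data.Nat using (ℕ; zero; suc; _≤_; _<_)
open import Data.Fin using (Fin; zero; suc; inject₁; fromℕ)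
open import Data.Product using (Σ; _×_)
open import Data.Sum using (_⊎_)
open import Relation.Binary.PropositionalEquality using (_≡_; _≢_)
open import Relation.Nullary using (¬_)
open import Function.Definitions using (Injective)

record Interval : Set where
  constructor [_,_]⟨_⟩
  field
    left  : ℕ
    right : ℕ
    left≤right : left ≤ right
open Interval public

Intersect : Interval → Interval → Set
Intersect I J = (left I ≤ right J) × (left J ≤ right I)

IntervalModel : ℕ → Set
IntervalModel n = Fin n → Interval

Adj : ∀ {n} → IntervalModel n → Fin n → Fin n → Set
Adj I u v = (u ≢ v) × Intersect (I u) (I v)

HasClique : ∀ {n} → IntervalModel n → ℕ → Set
HasClique {n} I m =
  Σ (Fin m → Fin n) λ f → Injective _≡_ _≡_ f × (∀ a b → a ≢ b → Adj I (f a) (f b))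

CliqueNumber≡ : ∀ {n} → IntervalModel n → ℕ → Set
CliqueNumber≡ I k = HasClique I k × ¬ HasClique I (suc k)

record IsOrientation {n} (I : IntervalModel n) (Arc : Fin n → Fin n → Set) : Set where
  field
    arc⇒adj  : ∀ u v → Arc u v → Adj I u v
    adj⇒arc  : ∀ u v → Adj I u v → Arc u v ⊎ Arc v u
    not-both : ∀ u v → ¬ (Arc u v × Arc v u)

record DirectedCycle {n} (Arc : Fin n → Fin n → Set) (m : ℕ) (c : Fin (suc m) → Fin n) : Set where
  field
    distinct : Injective _≡_ _≡_ c
    step     : ∀ (i : Fin m) → Arc (c (inject₁ i)) (c (suc i))
    close    : Arc (c (fromℕ m)) (c zero)

IsDicolouring : ∀ {n} (Arc : Fin n → Fin n → Set) (k : ℕ) → (Fin n → Fin k) → Set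
IsDicolouring {n} Arc k col =
  ∀ (m : ℕ) (c : Fin (suc m) → Fin n) → DirectedCycle Arc m c →
    ¬ (∀ i → col (c i) ≡ col (c zero))

DichromaticAtLeast : ∀ {n} (Arc : Fin n → Fin n → Set) → ℕ → Set
DichromaticAtLeast {n} Arc t =
  ∀ (k : ℕ) → k < t → ¬ (Σ (Fin n → Fin k) λ col → IsDicolouring Arc k col)

{-# OPTIONS --safe #-}
module Submission where

-- G_k is a laminar family of intervals: a tree of height k whose level-l vertices are the
-- words of length l over an alphabet of 2^k letters. A word of the deepest level is a
-- point, and every other word is the block spanned by its children, so two words meet iff
-- one is a prefix of the other; cliques are chains of prefixes and ω = k. The last letter
-- of a word encodes, for every shorter prefix, the direction of the arc between them.
-- Given a colouring with c colours and 2c < k, an adversary descends the tree choosing each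
-- letter from the colours met so far: the arc from the i-th vertex to the new one points
-- forward iff colour i occurs for the first time at i and again before the new vertex.
-- Some colour occurs three times among the first 2c+1 vertices; its first occurrence a,
-- second occurrence b and any later occurrence v span the directed triangle b → a → v → b.

open import Defs
open import Data.Bool using (Bool; true; false; not)
open import Data.Bool.Properties using (not-¬)
open import Data.Empty using (⊥)
open import Data.Fin as Fin using (Fin; zero; suc; toℕ; inject₁; fromℕ; splitAt; _↑ˡ_; _↑ʳ_)
open import Data.Fin.Properties
  using (0↔⊥; 1↔⊤; 2↔Bool; +↔⊎; *↔×; pigeonhole; toℕ-combine; toℕ<n; toℕ-injective;
         toℕ-fromℕ; toℕ-inject₁; fromℕ≢inject₁; inject₁-injective; splitAt-↑ˡ; splitAt-↑ʳ)
open import Data.Nat using (ℕ; zero; suc; _+_; _*_; _≤_; _<_; _<?_; z≤n; s≤s; s≤s⁻¹; ⌈_/2⌉)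
open import Data.Nat.Properties
open import Data.Product using (Σ; ∃; ∃₂; _×_; _,_; proj₁; proj₂; swap)
open import Data.Product.Function.NonDependent.Propositional using (_×-↔_)
open import Data.Sum as Sum using (_⊎_; inj₁; inj₂; [_,_])
open import Data.Sum.Function.Propositional using (_⊎-↔_)
open import Data.Unit using (⊤; tt)
open import Data.Vec using (_∷_; []; lookup)
open import Function using (_∘_)
open import Function.Bundles using (_↔_; Inverse; Injection; mk⇔)
open import Function.Definitions using (Injective)
open import Function.Properties.Inverse using (↔-refl; ↔-sym; ↔-trans; ↔⇒↣)
open import Relation.Binary.PropositionalEquality
  using (_≡_; _≢_; refl; sym; trans; cong; subst₂; ≢-sym; module ≡-Reasoning)
open import Relation.Nullary using (¬_; Dec; yes; no; does; contradiction; _×-dec_; ¬?)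
open import Relation.Nullary.Decidable using (dec-true; dec-false; does-⇔)
open import Relation.Unary using (Decidable)

*-cancelˡ-≤-slack : ∀ r {a b} → suc r * a ≤ suc r * b + r → a ≤ b
*-cancelˡ-≤-slack r {a} {b} h with a ≤? b
... | yes a≤b = a≤b
... | no a≰b = contradiction h (<⇒≱ (begin-strict
  suc r * b + r     <⟨ +-monoʳ-< (suc r * b) (n<1+n r) ⟩
  suc r * b + suc r ≡⟨ +-comm (suc r * b) (suc r) ⟩
  suc r + suc r * b ≡⟨ *-suc (suc r) b ⟨
  suc r * suc b     ≤⟨ *-monoʳ-≤ (suc r) (≰⇒> a≰b) ⟩
  suc r * a         ∎))
  where open ≤-Reasoning

<⌈/2⌉⇒2*<  : ∀ {c k} → c < ⌈ k /2⌉ → 2 * c < k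
<⌈/2⌉⇒2*< {zero}  {suc k}       _        = s≤s z≤n
<⌈/2⌉⇒2*< {suc c} {suc (suc k)} (s≤s c<) rewrite *-suc 2 c = s≤s (s≤s (<⌈/2⌉⇒2*< c<))

pigeonhole-↔ : ∀ {A : Set} {m n} → A ↔ Fin m → m < n → (f : Fin n → A) →
               ∃₂ λ i j → i Fin.< j × f i ≡ f j
pigeonhole-↔ A↔Fin m<n f with pigeonhole m<n (Inverse.to A↔Fin ∘ f)
... | i , j , i<j , fi≡fj = i , j , i<j , Injection.injective (↔⇒↣ A↔Fin) fi≡fj

least : ∀ {P : ℕ → Set} → Decidable P → ∀ {n} → P n →
        ∃ λ m → m ≤ n × P m × (∀ {q} → q < m → ¬ P q)
least {P} P? {n} Pn with firstBelow (suc n)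
  where
  firstBelow : ∀ n → (∃ λ m → m < n × P m × (∀ {q} → q < m → ¬ P q)) ⊎
                     (∀ {q} → q < n → ¬ P q)
  firstBelow zero = inj₂ λ ()
  firstBelow (suc n) with firstBelow n
  ... | inj₁ (m , m<n , Pm , below) = inj₁ (m , m≤n⇒m≤1+n m<n , Pm , below)
  ... | inj₂ none with P? n
  ...   | yes Pn = inj₁ (n , n<1+n n , Pn , none)
  ...   | no ¬Pn = inj₂ λ q<1+n → [ none , (λ { refl → ¬Pn }) ] (m<1+n⇒m<n∨m≡n q<1+n)
... | inj₁ (m , m<1+n , Pm , below) = m , s≤s⁻¹ m<1+n , Pm , below
... | inj₂ none = contradiction Pn (none (n<1+n n))

module ColourSequence {c : ℕ} where

  Repeated : (ℕ → Fin c) → ℕ → Set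
  Repeated s i = ∃ λ q → q < i × s q ≡ s i

  repeated? : ∀ s i → Dec (Repeated s i)
  repeated? s i = anyUpTo? (λ q → s q Fin.≟ s i) i

  -- Whether the adversary orients the edge between the i-th and t-th vertices of the
  -- branch towards the t-th; it reads the colouring only below t.
  Forward : (ℕ → Fin c) → ℕ → ℕ → Set
  Forward s t i = ¬ Repeated s i × ∃ λ q → q < t × i < q × s q ≡ s i

  forward? : ∀ s t i → Dec (Forward s t i)
  forward? s t i = ¬? (repeated? s i) ×-dec anyUpTo? (λ q → (i <? q) ×-dec (s q Fin.≟ s i)) t

  forward-transfer : ∀ {s s′ t i} → i < t → (∀ {q} → q < t → s q ≡ s′ q) →
                     Forward s t i → Forward s′ t i
  forward-transfer i<t s≗s′ (fresh , q , q<t , i<q , sq≡si) =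
    (λ (p , p<i , s′p≡s′i) →
       fresh (p , p<i , trans (s≗s′ (<-trans p<i i<t)) (trans s′p≡s′i (sym (s≗s′ i<t))))) ,
    q , q<t , i<q , trans (sym (s≗s′ q<t)) (trans sq≡si (s≗s′ i<t))

  Bool×Fin↔Fin : (Bool × Fin c) ↔ Fin (2 * c)
  Bool×Fin↔Fin = ↔-trans (↔-sym 2↔Bool ×-↔ ↔-refl) (↔-sym *↔×)

  record Triangle (s : ℕ → Fin c) (n : ℕ) : Set where
    field
      a b v       : ℕ
      a<b         : a < b
      b<v         : b < v
      v<n         : v < n
      b≡a         : s b ≡ s a
      v≡a         : s v ≡ s a
      backward-ab : ¬ Forward s b a
      forward-av  : Forward s v a
      backward-bv : ¬ Forward s v b

  firstRepetition⇒Triangle : ∀ {s n a b v} → a < b → b < v → v < n → s a ≡ s b → s v ≡ s b →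
                             (∀ {q} → q < b → ¬ (Repeated s q × s q ≡ s b)) → Triangle s n
  firstRepetition⇒Triangle {s} {a = a} {b} {v} a<b b<v v<n sa≡sb sv≡sb first = record
    { a = a ; b = b ; v = v ; a<b = a<b ; b<v = b<v ; v<n = v<n
    ; b≡a = sym sa≡sb
    ; v≡a = trans sv≡sb (sym sa≡sb)
    ; backward-ab = λ (_ , q , q<b , a<q , sq≡sa) →
        first q<b ((a , a<q , sym sq≡sa) , trans sq≡sa sa≡sb)
    ; forward-av = (λ repeated → first a<b (repeated , sa≡sb)) , b , b<v , a<b , sym sa≡sb
    ; backward-bv = λ (fresh , _) → fresh (a , a<b , sa≡sb)
    }

  -- Pigeonhole on (Repeated s i , s i) gives i < j of one colour, both repeated, so that
  -- colour occurs three times; b is then the first index repeating it.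
  triangle : ∀ s → Triangle s (suc (2 * c))
  triangle s with pigeonhole-↔ Bool×Fin↔Fin (n<1+n (2 * c))
                    (λ i → does (repeated? s (toℕ i)) , s (toℕ i))
  ... | i , j , i<j , flags≡ with repeated? s (toℕ i) | cong proj₁ flags≡
  ... | yes repeated-i | _
    with least (λ q → repeated? s q ×-dec (s q Fin.≟ s (toℕ i))) (repeated-i , refl)
  ... | b , b≤i , ((a , a<b , sa≡sb) , sb≡si) , minimal =
    firstRepetition⇒Triangle a<b (≤-<-trans b≤i i<j) (toℕ<n j) sa≡sb
      (trans (sym (cong proj₂ flags≡)) (sym sb≡si))
      (λ q<b (repeated , sq≡sb) → minimal q<b (repeated , trans sq≡sb sb≡si))
  triangle s | i , j , i<j , flags≡ | no _ | false≡flag-j =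
    contradiction (trans false≡flag-j
                         (dec-true (repeated? s (toℕ j)) (toℕ i , i<j , cong proj₂ flags≡)))
                  λ ()

-- maxCode k = 2 ^ k ∸ 1, written so that suc (maxCode (suc k)) unfolds to
-- suc (maxCode k) + suc (maxCode k); a code is a string of k bits.
maxCode : ℕ → ℕ
maxCode zero    = zero
maxCode (suc k) = maxCode k + suc (maxCode k)

Code : ℕ → Set
Code k = Fin (suc (maxCode k))

consCode : ∀ k → Bool → Code k → Code (suc k)
consCode k false j = j ↑ˡ suc (maxCode k)
consCode k true  j = suc (maxCode k) ↑ʳ j

unconsCode : ∀ k → Code (suc k) → Bool × Code k
unconsCode k j with splitAt (suc (maxCode k)) j
... | inj₁ j′ = false , j′
... | inj₂ j′ = true , j′

unconsCode-consCode : ∀ k b (j : Code k) → unconsCode k (consCode k b j) ≡ (b , j)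
unconsCode-consCode k false j rewrite splitAt-↑ˡ (suc (maxCode k)) j (suc (maxCode k)) = refl
unconsCode-consCode k true  j rewrite splitAt-↑ʳ (suc (maxCode k)) (suc (maxCode k)) j = refl

bit : ∀ k → Code k → ℕ → Bool
bit zero    _ _       = false
bit (suc k) j zero    = proj₁ (unconsCode k j)
bit (suc k) j (suc i) = bit k (proj₂ (unconsCode k j)) i

encode : ∀ k → (ℕ → Bool) → Code k
encode zero    f = zero
encode (suc k) f = consCode k (f zero) (encode k (f ∘ suc))

bit-encode : ∀ k f {i} → i < k → bit k (encode k f) i ≡ f i
bit-encode (suc k) f {zero}  _ rewrite unconsCode-consCode k (f zero) (encode k (f ∘ suc)) = refl
bit-encode (suc k) f {suc i} (s≤s i<k)
  rewrite unconsCode-consCode k (f zero) (encode k (f ∘ suc)) = bit-encode k (f ∘ suc) i<k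

triangleCycle : ∀ {n} {Arc : Fin n → Fin n → Set} → (∀ {u v} → Arc u v → u ≢ v) →
                ∀ {u v w} → Arc u v → Arc v w → Arc w u →
                DirectedCycle Arc 2 (lookup (u ∷ v ∷ w ∷ []))
triangleCycle arc⇒≢ {u} {v} {w} uv vw wu = record
  { distinct = injective
  ; step     = λ { zero → uv ; (suc zero) → vw }
  ; close    = wu
  }
  where
  injective : Injective _≡_ _≡_ (lookup (u ∷ v ∷ w ∷ []))
  injective {zero}             {zero}             _ = refl
  injective {suc zero}         {suc zero}         _ = refl
  injective {suc (suc zero)}   {suc (suc zero)}   _ = refl
  injective {zero}             {suc zero}         e = contradiction e (arc⇒≢ uv)
  injective {suc zero}         {zero}             e = contradiction (sym e) (arc⇒≢ uv)
  injective {suc zero}         {suc (suc zero)}   e = contradiction e (arc⇒≢ vw)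
  injective {suc (suc zero)}   {suc zero}         e = contradiction (sym e) (arc⇒≢ vw)
  injective {suc (suc zero)}   {zero}             e = contradiction e (arc⇒≢ wu)
  injective {zero}             {suc (suc zero)}   e = contradiction (sym e) (arc⇒≢ wu)

module IntervalDigraph {V : Set} (interval : V → Interval) (arc : V → V → Bool) where

  Edge : V → V → Set
  Edge x y = x ≢ y × Intersect (interval x) (interval y)

  Arrow : V → V → Set
  Arrow x y = Edge x y × arc x y ≡ true

  MonochromaticTriangle : ∀ {c} → (V → Fin c) → Set
  MonochromaticTriangle colour = ∃₂ λ x y → ∃ λ z →
    Arrow x y × Arrow y z × Arrow z x × colour y ≡ colour x × colour z ≡ colour x

  module Indexed {n} (V↔Fin : V ↔ Fin n) where

    index : V → Fin n
    index = Inverse.to V↔Fin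

    vertex : Fin n → V
    vertex = Inverse.from V↔Fin

    vertex-index : ∀ x → vertex (index x) ≡ x
    vertex-index = Inverse.strictlyInverseʳ V↔Fin

    index-injective : Injective _≡_ _≡_ index
    index-injective = Injection.injective (↔⇒↣ V↔Fin)

    vertex-injective : Injective _≡_ _≡_ vertex
    vertex-injective = Injection.injective (↔⇒↣ (↔-sym V↔Fin))

    model : IntervalModel n
    model = interval ∘ vertex

    Arc : Fin n → Fin n → Set
    Arc u v = Adj model u v × arc (vertex u) (vertex v) ≡ true

    Edge⇒Adj : ∀ {x y} → Edge x y → Adj model (index x) (index y)
    Edge⇒Adj {x} {y} (x≢y , x∩y) =
      x≢y ∘ index-injective ,
      subst₂ (λ x′ y′ → Intersect (interval x′) (interval y′))
             (sym (vertex-index x)) (sym (vertex-index y)) x∩y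

    Arrow⇒Arc : ∀ {x y} → Arrow x y → Arc (index x) (index y)
    Arrow⇒Arc {x} {y} (x—y , x→y) =
      Edge⇒Adj x—y ,
      subst₂ (λ x′ y′ → arc x′ y′ ≡ true) (sym (vertex-index x)) (sym (vertex-index y)) x→y

    isOrientation : (∀ x y → arc x y ≡ true → arc y x ≡ true → ⊥) →
                    (∀ x y → Edge x y → arc x y ≡ true ⊎ arc y x ≡ true) →
                    IsOrientation model Arc
    isOrientation asym total = record
      { arc⇒adj  = λ _ _ → proj₁
      ; adj⇒arc  = λ u v (u≢v , u∩v) →
          Sum.map ((u≢v , u∩v) ,_) ((u≢v ∘ sym , swap u∩v) ,_)
                  (total (vertex u) (vertex v) (u≢v ∘ vertex-injective , u∩v))
      ; not-both = λ u v ((_ , u→v) , (_ , v→u)) → asym (vertex u) (vertex v) u→v v→u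
      }

    hasClique : ∀ {m} (f : Fin m → V) → Injective _≡_ _≡_ f →
                (∀ a b → Intersect (interval (f a)) (interval (f b))) → HasClique model m
    hasClique f f-injective f∩f =
      index ∘ f , f-injective ∘ index-injective ,
      λ a b a≢b → Edge⇒Adj (a≢b ∘ f-injective , f∩f a b)

    noClique : ∀ {h} (level : V → Fin h) →
               (∀ {x y} → Intersect (interval x) (interval y) → level x ≡ level y → x ≡ y) →
               ¬ HasClique model (suc h)
    noClique {h} level level-separates (f , _ , adjacent)
      with pigeonhole (n<1+n h) (level ∘ vertex ∘ f)
    ... | i , j , i<j , same-level =
      let (fi≢fj , fi∩fj) = adjacent i j (<⇒≢ i<j ∘ cong toℕ)
      in fi≢fj (vertex-injective (level-separates fi∩fj same-level))

    monochromaticTriangle⇒¬IsDicolouring :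
      ∀ {c} (col : Fin n → Fin c) → MonochromaticTriangle (col ∘ index) →
      ¬ IsDicolouring Arc c col
    monochromaticTriangle⇒¬IsDicolouring col (_ , _ , _ , x→y , y→z , z→x , y∼x , z∼x) dicol =
      dicol 2 _ (triangleCycle (proj₁ ∘ proj₁) (Arrow⇒Arc x→y) (Arrow⇒Arc y→z) (Arrow⇒Arc z→x))
        λ { zero → refl ; (suc zero) → y∼x ; (suc (suc zero)) → z∼x }

module WordTree (r : ℕ) where

  Letter : Set
  Letter = Fin (suc r)

  Word : ℕ → Set
  Word zero    = ⊤
  Word (suc l) = Word l × Letter

  wordCount : ℕ → ℕ
  wordCount zero    = 1
  wordCount (suc l) = wordCount l * suc r

  Word↔Fin : ∀ l → Word l ↔ Fin (wordCount l)
  Word↔Fin zero    = ↔-sym 1↔⊤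
  Word↔Fin (suc l) = ↔-trans (Word↔Fin l ×-↔ ↔-refl) (↔-sym *↔×)

  position : ∀ {l} → Word l → ℕ
  position {l} = toℕ ∘ Inverse.to (Word↔Fin l)

  position-injective : ∀ {l} {w w′ : Word l} → position w ≡ position w′ → w ≡ w′
  position-injective {l} = Injection.injective (↔⇒↣ (Word↔Fin l)) ∘ toℕ-injective

  position-extend : ∀ {l} (w : Word l) j → position (w , j) ≡ suc r * position w + toℕ j
  position-extend {l} w = toℕ-combine (Inverse.to (Word↔Fin l) w)

  Vertex : ℕ → Set
  Vertex zero    = ⊥
  Vertex (suc h) = Vertex h ⊎ Word h

  vertexCount : ℕ → ℕ
  vertexCount zero    = 0
  vertexCount (suc h) = vertexCount h + wordCount h

  Vertex↔Fin : ∀ h → Vertex h ↔ Fin (vertexCount h)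
  Vertex↔Fin zero    = ↔-sym 0↔⊥
  Vertex↔Fin (suc h) = ↔-trans (Vertex↔Fin h ⊎-↔ Word↔Fin h) (↔-sym +↔⊎)

  -- Each point p becomes the block [(r+1) p , (r+1) p + r] of the positions of its children.
  scale : Interval → Interval
  scale [ a , b ]⟨ a≤b ⟩ =
    [ suc r * a , suc r * b + r ]⟨ ≤-trans (*-monoʳ-≤ (suc r) a≤b) (m≤m+n (suc r * b) r) ⟩

  point : ℕ → Interval
  point p = [ p , p ]⟨ ≤-refl ⟩

  interval : ∀ {h} → Vertex h → Interval
  interval {suc h} (inj₁ x) = scale (interval x)
  interval {suc h} (inj₂ w) = point (position w)

  level : ∀ {h} → Vertex h → Fin h
  level {suc h} (inj₁ x) = inject₁ (level x)
  level {suc h} (inj₂ _) = fromℕ h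

  scale-reflects-Intersect : ∀ I J → Intersect (scale I) (scale J) → Intersect I J
  scale-reflects-Intersect [ _ , _ ]⟨ _ ⟩ [ _ , _ ]⟨ _ ⟩ (p , q) =
    *-cancelˡ-≤-slack r p , *-cancelˡ-≤-slack r q

  Intersect-level⇒≡ : ∀ {h} {x y : Vertex h} →
                      Intersect (interval x) (interval y) → level x ≡ level y → x ≡ y
  Intersect-level⇒≡ {suc h} {inj₁ x} {inj₁ y} x∩y same =
    cong inj₁ (Intersect-level⇒≡ (scale-reflects-Intersect (interval x) (interval y) x∩y)
                                 (inject₁-injective same))
  Intersect-level⇒≡ {suc h} {inj₁ x} {inj₂ w} _ same = contradiction (sym same) fromℕ≢inject₁
  Intersect-level⇒≡ {suc h} {inj₂ w} {inj₁ x} _ same = contradiction same fromℕ≢inject₁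
  Intersect-level⇒≡ {suc h} {inj₂ w} {inj₂ w′} (p≤p′ , p′≤p) _ =
    cong inj₂ (position-injective (≤-antisym p≤p′ p′≤p))

  Contains : Interval → ℕ → Set
  Contains I p = left I ≤ p × p ≤ right I

  Contains⇒Intersect : ∀ I J {p} → Contains I p → Contains J p → Intersect I J
  Contains⇒Intersect _ _ (a≤p , p≤b) (c≤p , p≤d) = ≤-trans a≤p p≤d , ≤-trans c≤p p≤b

  scale-Contains : ∀ I {p} → Contains I p → ∀ (j : Letter) →
                   Contains (scale I) (suc r * p + toℕ j)
  scale-Contains [ _ , _ ]⟨ _ ⟩ (a≤p , p≤b) j =
    ≤-trans (*-monoʳ-≤ (suc r) a≤p) (m≤m+n _ _) ,
    +-mono-≤ (*-monoʳ-≤ (suc r) p≤b) (s≤s⁻¹ (toℕ<n j))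

  -- Words longer than h have no vertex in the tree of height suc h; they go to the root.
  embed : ∀ h {l} → Word l → Vertex (suc h)
  embed h {l} w with l ≟ h
  ... | yes refl = inj₂ w
  embed zero    w | no _ = inj₂ tt
  embed (suc h) w | no _ = inj₁ (embed h w)

  embed-top : ∀ h (w : Word h) → embed h w ≡ inj₂ w
  embed-top h w with h ≟ h
  ... | yes refl = refl
  ... | no h≢h = contradiction refl h≢h

  embed-step : ∀ {h l} (w : Word l) → l ≤ h → embed (suc h) w ≡ inj₁ (embed h w)
  embed-step {h} {l} w l≤h with l ≟ suc h
  ... | yes refl = contradiction l≤h (1+n≰n)
  ... | no _ = refl

  level-embed : ∀ h {l} (w : Word l) → l ≤ h → toℕ (level (embed h w)) ≡ l
  level-embed h w l≤h with m≤n⇒m<n∨m≡n l≤h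
  ... | inj₂ refl rewrite embed-top h w = toℕ-fromℕ h
  level-embed (suc h) w _ | inj₁ (s≤s l≤h) rewrite embed-step w l≤h =
    trans (toℕ-inject₁ (level (embed h w))) (level-embed h w l≤h)

  branch : (∀ l → Word l → Letter) → ∀ l → Word l
  branch g zero    = tt
  branch g (suc l) = branch g l , g l (branch g l)

  module _ (g : ∀ l → Word l → Letter) where

    branch-Contains : ∀ h {i} → i ≤ h →
                      Contains (interval (embed h (branch g i))) (position (branch g h))
    branch-Contains h i≤h with m≤n⇒m<n∨m≡n i≤h
    ... | inj₂ refl rewrite embed-top h (branch g h) = ≤-refl , ≤-refl
    branch-Contains (suc h) {i} _ | inj₁ (s≤s i≤h)
      rewrite embed-step (branch g i) i≤h | position-extend (branch g h) (g h (branch g h)) =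
      scale-Contains (interval (embed h (branch g i))) (branch-Contains h i≤h) (g h (branch g h))

    branch-Intersect : ∀ h {i j} → i ≤ h → j ≤ h →
                       Intersect (interval (embed h (branch g i))) (interval (embed h (branch g j)))
    branch-Intersect h {i} {j} i≤h j≤h =
      Contains⇒Intersect (interval (embed h (branch g i))) (interval (embed h (branch g j)))
                         (branch-Contains h i≤h) (branch-Contains h j≤h)

    branch-injective : ∀ h {i j} → i ≤ h → j ≤ h →
                       embed h (branch g i) ≡ embed h (branch g j) → i ≡ j
    branch-injective h {i} {j} i≤h j≤h same = begin
      i                                       ≡⟨ level-embed h (branch g i) i≤h ⟨
      toℕ (level (embed h (branch g i)))      ≡⟨ cong (toℕ ∘ level) same ⟩
      toℕ (level (embed h (branch g j)))      ≡⟨ level-embed h (branch g j) j≤h ⟩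
      j                                       ∎
      where open ≡-Reasoning

  module Orientation (out : Letter → ℕ → Bool) where

    -- Whether the edge between x and the deeper vertex w points to w: the last letter of w
    -- decides, according to the level of x.
    into : ∀ {h} → Word h → Vertex h → Bool
    into {suc h} (_ , j) x = out j (toℕ (level x))

    arc : ∀ {h} → Vertex h → Vertex h → Bool
    arc {suc h} (inj₁ x) (inj₁ y) = arc x y
    arc {suc h} (inj₁ x) (inj₂ w) = into w x
    arc {suc h} (inj₂ w) (inj₁ x) = not (into w x)
    arc {suc h} (inj₂ _) (inj₂ _) = false

    module _ {h : ℕ} where
      open IntervalDigraph (interval {h}) (arc {h}) public using (Edge; Arrow; MonochromaticTriangle)

    arc-asym : ∀ {h} (x y : Vertex h) → arc x y ≡ true → arc y x ≡ true → ⊥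
    arc-asym {suc h} (inj₁ x) (inj₁ y) x→y y→x = arc-asym x y x→y y→x
    arc-asym {suc h} (inj₁ x) (inj₂ w) x→w w→x = not-¬ refl (trans x→w (sym w→x))
    arc-asym {suc h} (inj₂ w) (inj₁ x) w→x x→w = not-¬ refl (trans x→w (sym w→x))

    arc-total : ∀ {h} (x y : Vertex h) → Edge x y → arc x y ≡ true ⊎ arc y x ≡ true
    arc-total {suc h} (inj₁ x) (inj₁ y) (x≢y , x∩y) =
      arc-total x y (x≢y ∘ cong inj₁ , scale-reflects-Intersect (interval x) (interval y) x∩y)
    arc-total {suc h} (inj₁ x) (inj₂ w) _ with into w x
    ... | true  = inj₁ refl
    ... | false = inj₂ refl
    arc-total {suc h} (inj₂ w) (inj₁ x) _ with into w x
    ... | true  = inj₂ refl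
    ... | false = inj₁ refl
    arc-total {suc h} (inj₂ w) (inj₂ w′) (w≢w′ , w∩w′) =
      contradiction (Intersect-level⇒≡ w∩w′ refl) w≢w′

    arc-flip : ∀ {h} {x y : Vertex h} → Edge x y → arc x y ≡ false → arc y x ≡ true
    arc-flip {x = x} {y} x—y x↛y with arc-total x y x—y
    ... | inj₁ x→y = contradiction (trans (sym x→y) x↛y) λ ()
    ... | inj₂ y→x = y→x

    arc-branch : ∀ g h {i t} → i ≤ t → suc t ≤ h →
                 arc (embed h (branch g i)) (embed h (branch g (suc t))) ≡ out (g t (branch g t)) i
    arc-branch g (suc h) {i} {t} i≤t (s≤s t≤h) with m≤n⇒m<n∨m≡n t≤h
    ... | inj₂ refl rewrite embed-top (suc t) (branch g (suc t)) | embed-step (branch g i) i≤t =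
      cong (out (g t (branch g t))) (level-embed t (branch g i) i≤t)
    ... | inj₁ t<h
      rewrite embed-step (branch g i) (≤-trans i≤t t≤h) | embed-step (branch g (suc t)) t<h =
      arc-branch g h i≤t t<h

    branch-Edge : ∀ g h {i j} → i ≤ h → j ≤ h → i ≢ j →
                  Edge (embed h (branch g i)) (embed h (branch g j))
    branch-Edge g h i≤h j≤h i≢j =
      i≢j ∘ branch-injective g h i≤h j≤h , branch-Intersect g h i≤h j≤h

    module Adversary {c h} (colour : Vertex (suc h) → Fin c) (code : (ℕ → Bool) → Letter)
                     (out-code : ∀ f {i} → i ≤ h → out (code f) i ≡ f i) where

      open ColourSequence {c}

      ancestorColours : ∀ {l} → Word l → ℕ → Fin c
      ancestorColours {zero}  w       _ = colour (embed h w)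
      ancestorColours {suc l} (w , j) i with i ≤? l
      ... | yes _ = ancestorColours w i
      ... | no _  = colour (embed h (w , j))

      strategy : ∀ l → Word l → Letter
      strategy l w = code (λ i → does (forward? (ancestorColours w) (suc l) i))

      node : ℕ → Vertex (suc h)
      node i = embed h (branch strategy i)

      branchColour : ℕ → Fin c
      branchColour = colour ∘ node

      ancestorColours-branch : ∀ {l i} → i ≤ l →
                               ancestorColours (branch strategy l) i ≡ branchColour i
      ancestorColours-branch {zero}  z≤n = refl
      ancestorColours-branch {suc l} {i} i≤1+l with i ≤? l
      ... | yes i≤l = ancestorColours-branch i≤l
      ... | no i≰l with ≤-antisym i≤1+l (≰⇒> i≰l)
      ...   | refl = refl

      arc-node : ∀ {i t} → i < t → t ≤ h →
                 arc (node i) (node t) ≡ does (forward? branchColour t i)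
      arc-node {i} {suc t} i<1+t 1+t≤h = begin
        arc (node i) (node (suc t))
          ≡⟨ arc-branch strategy h (s≤s⁻¹ i<1+t) 1+t≤h ⟩
        out (strategy t (branch strategy t)) i
          ≡⟨ out-code _ (≤-trans (s≤s⁻¹ i<1+t) (<⇒≤ 1+t≤h)) ⟩
        does (forward? (ancestorColours (branch strategy t)) (suc t) i)
          ≡⟨ does-⇔ (mk⇔ (forward-transfer i<1+t agree) (forward-transfer i<1+t (sym ∘ agree)))
                    (forward? _ (suc t) i) (forward? branchColour (suc t) i) ⟩
        does (forward? branchColour (suc t) i)
          ∎
        where
        open ≡-Reasoning
        agree : ∀ {q} → q < suc t → ancestorColours (branch strategy t) q ≡ branchColour q
        agree = ancestorColours-branch ∘ s≤s⁻¹

      forwardArrow : ∀ {i t} → i < t → t ≤ h → Forward branchColour t i → Arrow (node i) (node t)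
      forwardArrow {i} {t} i<t t≤h forward =
        branch-Edge strategy h (<⇒≤ (<-≤-trans i<t t≤h)) t≤h (<⇒≢ i<t) ,
        trans (arc-node i<t t≤h) (dec-true (forward? branchColour t i) forward)

      backwardArrow : ∀ {i t} → i < t → t ≤ h → ¬ Forward branchColour t i →
                      Arrow (node t) (node i)
      backwardArrow {i} {t} i<t t≤h backward =
        branch-Edge strategy h t≤h i≤h (≢-sym (<⇒≢ i<t)) ,
        arc-flip (branch-Edge strategy h i≤h t≤h (<⇒≢ i<t))
                 (trans (arc-node i<t t≤h) (dec-false (forward? branchColour t i) backward))
        where i≤h = <⇒≤ (<-≤-trans i<t t≤h)

      monochromaticTriangle : 2 * c < suc h → MonochromaticTriangle colour
      monochromaticTriangle 2c<1+h =
        node b , node a , node v ,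
        backwardArrow a<b b≤h backward-ab ,
        forwardArrow (<-trans a<b b<v) v≤h forward-av ,
        backwardArrow b<v v≤h backward-bv ,
        sym b≡a , trans v≡a (sym b≡a)
        where
        open Triangle (triangle branchColour)
        v≤h = s≤s⁻¹ (<-≤-trans v<n 2c<1+h)
        b≤h = <⇒≤ (<-≤-trans b<v v≤h)

module Construction (k : ℕ) where

  open WordTree (maxCode k) public
  open Orientation (bit k) public

  module Graph h = IntervalDigraph.Indexed (interval {h}) (arc {h}) (Vertex↔Fin h)

  orientation : ∀ h → IsOrientation (Graph.model h) (Graph.Arc h)
  orientation h = Graph.isOrientation h arc-asym arc-total

  clique : ∀ h → HasClique (Graph.model h) h
  clique zero    = Graph.hasClique zero (λ ()) (λ {}) (λ ())
  clique (suc h) = Graph.hasClique (suc h) (λ i → embed h (branch g (toℕ i)))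
    (λ same → toℕ-injective (branch-injective g h (i≤h _) (i≤h _) same))
    (λ i j → branch-Intersect g h (i≤h i) (i≤h j))
    where
    g : ∀ l → Word l → Letter
    g _ _ = zero
    i≤h : ∀ (i : Fin (suc h)) → toℕ i ≤ h
    i≤h i = s≤s⁻¹ (toℕ<n i)

  noLargerClique : ∀ h → ¬ HasClique (Graph.model h) (suc h)
  noLargerClique h = Graph.noClique h level Intersect-level⇒≡

  dichromatic : ∀ h → h ≤ k → DichromaticAtLeast (Graph.Arc h) ⌈ h /2⌉
  dichromatic zero    _     _ ()
  dichromatic (suc h) 1+h≤k c c<⌈h/2⌉ (col , dicolouring) =
    Graph.monochromaticTriangle⇒¬IsDicolouring (suc h) col
      (Adversary.monochromaticTriangle (col ∘ Graph.index (suc h)) (encode k)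
        (λ f i≤h → bit-encode k f (≤-trans (s≤s i≤h) 1+h≤k)) (<⌈/2⌉⇒2*< c<⌈h/2⌉))
      dicolouring

mainTheorem1 : (k : ℕ) →
    Σ ℕ λ n → Σ (IntervalModel n) λ I → Σ (Fin n → Fin n → Set) λ Arc →
      IsOrientation I Arc × CliqueNumber≡ I k × DichromaticAtLeast Arc ⌈ k /2⌉
mainTheorem1 k =
  vertexCount k , Graph.model k , Graph.Arc k ,
  orientation k , (clique k , noLargerClique k) , dichromatic k ≤-refl
  where open Construction k
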